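{- Let $m,n,t\ge 0$ be integers with $t\le mn$. Let $T$ be a SYT of rectangular shape $(n^m)$. Let $T_1$ be the set of cells of $T$ (with their entries) whose entries are at most $t$, and let $T_2$ be obtained from $T\setminus T_1$ by moving each cell $(i,j)$ to position $(n+1-j,\,m+1-i)$ and replacing its entry $x$ by $mn-x+1$. Then: (i) $T_1$ and $T_2$ are SYT (of ordinary shapes); (ii) denoting by $\lambda^1$ and $\lambda^2$ the shapes of $T_1$ and $T_2$ (padded with zeros to $m$ and $n$ parts respectively), the set $\{1,\ldots,m+n\}$ of parts of the strict partition $[m+n]$ is the disjoint union of the sets of parts of the strict partitions $\lambda^1+[m]$ and $\lambda^2+[n]$.
   Context: For a partition $\lambda$, its Young diagram consists of cells $(i,j)$ with $1\le j\le\lambda_i$; a SYT of shape $\lambda$ is a filling by $1,\ldots,|\lambda|$, each once, increasing along rows and down columns. $(n^m)=(n,\ldots,n)$ with $m$ parts (cells $(i,j)$, $1\le i\le m$, $1\le j\le n$). $[p]=(p,p-1,\ldots,1)$. The sum of two partitions with the same number of parts (after padding with trailing zeros) is taken componentwise. -}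

module Defs where

open import Data.Nat using (ℕ; zero; suc; _+_; _*_; _∸_; _≤_; _<_; _≤?_)
open import Data.Vec using (Vec; []; _∷_; replicate; sum)
open import Data.Maybe using (Maybe; just; nothing)
open import Data.Product using (_×_; ∃; ∃-syntax)
open import Data.Sum using (_⊎_)
open import Data.Empty using (⊥)
open import Relation.Binary.PropositionalEquality using (_≡_)
open import Relation.Nullary using (yes; no)

-- A (partial) filling of cells: F i j = just x means cell (i,j) (1-indexed,
-- row i, column j) is present with entry x; nothing means the cell is absent.
Filling : Set
Filling = ℕ → ℕ → Maybe ℕ

-- i-th part (1-indexed) of a shape given as a padded vector of parts;
-- 0 for index 0 and for indices beyond the length.
part : ∀ {k} → Vec ℕ k → ℕ → ℕ
part []       _             = 0
part (x ∷ xs) zero          = 0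
part (x ∷ xs) (suc zero)    = x
part (x ∷ xs) (suc (suc i)) = part xs (suc i)

IsPartition : ∀ {k} → Vec ℕ k → Set
IsPartition λ′ = ∀ i → part λ′ (suc (suc i)) ≤ part λ′ (suc i)

-- cell (i,j) of the Young diagram: 1 ≤ j ≤ λ_i (forces 1 ≤ i ≤ k)
InDiagram : ∀ {k} → Vec ℕ k → ℕ → ℕ → Set
InDiagram λ′ i j = (1 ≤ j) × (j ≤ part λ′ i)

IsSYT : ∀ {k} → Filling → Vec ℕ k → Set
IsSYT F λ′ =
    (∀ i j → (∃[ x ] F i j ≡ just x) → InDiagram λ′ i j)
  × (∀ i j → InDiagram λ′ i j → ∃[ x ] F i j ≡ just x)
  × (∀ i j x → F i j ≡ just x → (1 ≤ x) × (x ≤ sum λ′))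
  × (∀ x → 1 ≤ x → x ≤ sum λ′ → ∃[ i ] ∃[ j ] F i j ≡ just x)
  × (∀ i j i′ j′ x → F i j ≡ just x → F i′ j′ ≡ just x → (i ≡ i′) × (j ≡ j′))
  × (∀ i j x y → F i j ≡ just x → F i (suc j) ≡ just y → x < y)
  × (∀ i j x y → F i j ≡ just x → F (suc i) j ≡ just y → x < y)

rect : (m n : ℕ) → Vec ℕ m
rect m n = replicate m n

lowerPart : ℕ → Filling → Filling
lowerPart t T i j with T i j
... | nothing = nothing
... | just x with x ≤? t
...   | yes _ = just x
...   | no  _ = nothing

-- T₂: cells (i',j') of T with entry x > t, moved to (n+1-j', m+1-i')
-- with entry mn - x + 1.  Cell (i,j) of T₂ comes from (m+1-j, n+1-i) of T.
-- (Indices outside the rectangle are mapped by truncated subtraction to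
-- row/column 0 or m+1/n+1, where T has no cells.)
upperPart : (m n t : ℕ) → Filling → Filling
upperPart m n t T i j with T (suc m ∸ j) (suc n ∸ i)
... | nothing = nothing
... | just x with x ≤? t
...   | yes _ = nothing
...   | no  _ = just (suc (m * n) ∸ x)

-- v is a part of the strict partition λ′ + [k], where λ′ has k parts:
-- parts are λ′_i + (k + 1 - i) for 1 ≤ i ≤ k
PartOfPlusStaircase : ∀ {k} → Vec ℕ k → ℕ → Set
PartOfPlusStaircase {k} λ′ v =
  ∃[ i ] (1 ≤ i) × (i ≤ k) × (part λ′ i + (suc k ∸ i) ≡ v)

DisjointUnionRange : ℕ → (ℕ → Set) → (ℕ → Set) → Set
DisjointUnionRange N A B =
    (∀ v → 1 ≤ v → v ≤ N → A v ⊎ B v)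
  × (∀ v → A v → (1 ≤ v) × (v ≤ N))
  × (∀ v → B v → (1 ≤ v) × (v ≤ N))
  × (∀ v → A v → B v → ⊥)

-- Reading T backwards (rotate by 180°, transpose, replace each entry x by mn + 1 - x) gives a
-- standard tableau T* of shape (m^n), and T₂ is exactly the part of T* with entries at most
-- mn - t.  So part (i) is one fact used twice: in a rectangular SYT the cells with entries ≤ s
-- form an SYT whose i-th row length counts those cells in row i; there are exactly s of them
-- since each of 1, …, s occurs once.
-- For (ii), cell (a, c) lies in T₁ exactly when its image (n + 1 - c, m + 1 - a) does not lie
-- in T₂, so λ² is the rotated complement of λ¹ in the rectangle.  Hence a part λ¹_a + m + 1 - a
-- never equals a part λ²_k + n + 1 - k, and every v ∈ [1, m + n] falling into a gap between
-- consecutive parts of λ¹ + [m] is a part of λ² + [n].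

module Submission where

open import Defs
open import Data.Empty using (⊥)
open import Data.Maybe as Maybe using (Maybe; just; nothing)
open import Data.Maybe.Properties using (just-injective; ≡-dec)
open import Data.Maybe.Relation.Unary.Any as Any using (Any; just)
open import Data.Nat
open import Data.Nat.Properties
open import Algebra.Properties.CommutativeSemigroup +-commutativeSemigroup using (interchange)
open import Data.Product using (_×_; _,_; proj₁; proj₂; ∃-syntax)
open import Data.Sum using (_⊎_; inj₁; inj₂; [_,_]′)
open import Data.Vec using (Vec; []; _∷_; sum)
open import Function using (_∘_; _⇔_; mk⇔; Equivalence)
open import Relation.Binary.PropositionalEquality
open import Relation.Nullary using (Dec; yes; no; ¬_; contradiction)
open import Relation.Nullary.Decidable using (_⊎-dec_)
open import Function.Properties.Equivalence using () renaming (trans to ⇔-trans; sym to ⇔-sym)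
open import Relation.Unary using (Pred; Decidable)

open Equivalence using (to; from)

infix 4 _∈[1,_]
_∈[1,_] : ℕ → ℕ → Set
i ∈[1, k ] = 1 ≤ i × i ≤ k

flip-suc : ∀ {i k} → i ≤ k → suc k ∸ i ≡ suc (k ∸ i)
flip-suc = +-∸-assoc 1

flip-∈ : ∀ {i k} → i ∈[1, k ] → suc k ∸ i ∈[1, k ]
flip-∈ {suc i} {k} (_ , i≤k) = subst (1 ≤_) (sym (flip-suc i≤k)) (s≤s z≤n) , m∸n≤m k i

flip-involutive : ∀ {i k} → i ≤ k → suc k ∸ (suc k ∸ i) ≡ i
flip-involutive i≤k = m∸[m∸n]≡n (m≤n⇒m≤1+n i≤k)

flip-∈⁻¹ : ∀ {i k} → suc k ∸ i ∈[1, k ] → i ∈[1, k ]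
flip-∈⁻¹ {zero}  (_ , k+1≤k) = contradiction k+1≤k (n≮n _)
flip-∈⁻¹ {suc i} (0<k+1-i , _) = s≤s z≤n , ≤-pred (m∸n≢0⇒n<m (<⇒≢ 0<k+1-i ∘ sym))

flip-injective : ∀ {i i′ k} → i ≤ k → i′ ≤ k → suc k ∸ i ≡ suc k ∸ i′ → i ≡ i′
flip-injective i≤k i′≤k = ∸-cancelˡ-≡ (m≤n⇒m≤1+n i≤k) (m≤n⇒m≤1+n i′≤k)

flip-< : ∀ {i i′ k} → i < i′ → i′ ≤ k → suc k ∸ i′ < suc k ∸ i
flip-< i<i′ i′≤k = ∸-monoʳ-< i<i′ (m≤n⇒m≤1+n i′≤k)

flip-≤⇔ : ∀ {t x k} → t ≤ k → suc k ∸ x ≤ k ∸ t ⇔ t < x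
flip-≤⇔ {t} {x} {k} t≤k = mk⇔ (λ le → ≰⇒> λ x≤t → k+1-t≰k-t (≤-trans (∸-monoʳ-≤ (suc k) x≤t) le))
                             (∸-monoʳ-≤ (suc k))
  where
  k+1-t≰k-t : suc k ∸ t ≰ k ∸ t
  k+1-t≰k-t = subst (_≰ k ∸ t) (sym (flip-suc t≤k)) (n≮n (k ∸ t))

∑ : ℕ → (ℕ → ℕ) → ℕ
∑ zero    f = 0
∑ (suc k) f = ∑ k f + f (suc k)

∑-cong : ∀ k {f g} → (∀ i → f i ≡ g i) → ∑ k f ≡ ∑ k g
∑-cong zero    f≡g = refl
∑-cong (suc k) f≡g = cong₂ _+_ (∑-cong k f≡g) (f≡g (suc k))

∑-distrib-+ : ∀ k f g → ∑ k (λ i → f i + g i) ≡ ∑ k f + ∑ k g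
∑-distrib-+ zero    f g = refl
∑-distrib-+ (suc k) f g =
  trans (cong (_+ (f (suc k) + g (suc k))) (∑-distrib-+ k f g))
        (interchange (∑ k f) (∑ k g) (f (suc k)) (g (suc k)))

∑-const : ∀ k {f c} → (∀ i → i ∈[1, k ] → f i ≡ c) → ∑ k f ≡ k * c
∑-const zero    _   = refl
∑-const (suc k) {f} {c} f≡c = begin
  ∑ k f + f (suc k) ≡⟨ cong₂ _+_ (∑-const k (λ i (1≤i , i≤k) → f≡c i (1≤i , m≤n⇒m≤1+n i≤k)))
                                 (f≡c (suc k) (s≤s z≤n , ≤-refl)) ⟩
  k * c + c         ≡⟨ +-comm (k * c) c ⟩
  suc k * c         ∎
  where open ≡-Reasoning

∑-≤ : ∀ k {f c} → (∀ i → f i ≤ c) → ∑ k f ≤ k * c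
∑-≤ zero    _   = z≤n
∑-≤ (suc k) {f} {c} f≤c =
  ≤-trans (+-mono-≤ (∑-≤ k f≤c) (f≤c (suc k))) (≤-reflexive (+-comm (k * c) c))

∑-single : ∀ k {f i₀} → i₀ ∈[1, k ] → (∀ i → i ≢ i₀ → f i ≡ 0) → ∑ k f ≡ f i₀
∑-single zero    (s≤s _ , ()) _
∑-single (suc k) {f} {i₀} (1≤i₀ , i₀≤k+1) f≡0 with i₀ ≟ suc k
... | yes refl =
  cong (_+ f i₀) (trans (∑-const k (λ i (_ , i≤k) → f≡0 i (<⇒≢ (s≤s i≤k)))) (*-zeroʳ k))
... | no  i₀≢k+1 = begin
  ∑ k f + f (suc k) ≡⟨ cong₂ _+_ (∑-single k (1≤i₀ , ≤-pred (≤∧≢⇒< i₀≤k+1 i₀≢k+1)) f≡0)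
                                 (f≡0 (suc k) (i₀≢k+1 ∘ sym)) ⟩
  f i₀ + 0          ≡⟨ +-identityʳ (f i₀) ⟩
  f i₀              ∎
  where open ≡-Reasoning

∑-shift : ∀ k f → ∑ (suc k) f ≡ f 1 + ∑ k (f ∘ suc)
∑-shift zero    f = +-comm 0 (f 1)
∑-shift (suc k) f = trans (cong (_+ f (suc (suc k))) (∑-shift k f)) (+-assoc (f 1) _ _)

𝟙 : ∀ {p} {P : Set p} → Dec P → ℕ
𝟙 (yes _) = 1
𝟙 (no  _) = 0

module _ {p} {P : Set p} where

  𝟙-yes : (P? : Dec P) → P → 𝟙 P? ≡ 1
  𝟙-yes (yes _) _  = refl
  𝟙-yes (no ¬p) p  = contradiction p ¬p

  𝟙-no : (P? : Dec P) → ¬ P → 𝟙 P? ≡ 0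
  𝟙-no (yes p) ¬p = contradiction p ¬p
  𝟙-no (no  _) _  = refl

  𝟙≤1 : (P? : Dec P) → 𝟙 P? ≤ 1
  𝟙≤1 (yes _) = ≤-refl
  𝟙≤1 (no  _) = z≤n

count : ∀ {p} {P : Pred ℕ p} → Decidable P → ℕ → ℕ
count P? k = ∑ k (𝟙 ∘ P?)

module _ {p} {P : Pred ℕ p} (P? : Decidable P) where

  count-≤ : ∀ k → count P? k ≤ k
  count-≤ k = ≤-trans (∑-≤ k (𝟙≤1 ∘ P?)) (≤-reflexive (*-identityʳ k))

  count-all : ∀ k → (∀ i → i ∈[1, k ] → P i) → count P? k ≡ k
  count-all k all = trans (∑-const k (λ i i∈ → 𝟙-yes (P? i) (all i i∈))) (*-identityʳ k)

  count-none : ∀ k → (∀ i → i ∈[1, k ] → ¬ P i) → count P? k ≡ 0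
  count-none k none = trans (∑-const k (λ i i∈ → 𝟙-no (P? i) (none i i∈))) (*-zeroʳ k)

  count-unique : ∀ k {i₀} → i₀ ∈[1, k ] → P i₀ → (∀ i → P i → i ≡ i₀) → count P? k ≡ 1
  count-unique k i₀∈ p unique =
    trans (∑-single k i₀∈ (λ i i≢i₀ → 𝟙-no (P? i) (i≢i₀ ∘ unique i))) (𝟙-yes (P? _) p)

  count-suc-no : ∀ k → ¬ P (suc k) → count P? (suc k) ≡ count P? k
  count-suc-no k ¬p = trans (cong (count P? k +_) (𝟙-no (P? (suc k)) ¬p)) (+-identityʳ _)

  DownClosedOn : ℕ → Set p
  DownClosedOn k = ∀ j → 1 ≤ j → suc j ≤ k → P (suc j) → P j

  downClosed-≤ : ∀ {k} → DownClosedOn k → ∀ c → c ≤ k → P c → ∀ j → j ∈[1, c ] → P j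
  downClosed-≤ _      zero    _   _  _ (s≤s _ , ())
  downClosed-≤ closed (suc c) c<k pc j (1≤j , j≤c+1) with j ≟ suc c
  ... | yes refl = pc
  ... | no  j≢c+1 = downClosed-≤ closed c (≤-trans (n≤1+n c) c<k)
                      (closed c (≤-trans 1≤j j≤c) c<k pc) j (1≤j , j≤c)
    where
    j≤c : j ≤ c
    j≤c = ≤-pred (≤∧≢⇒< j≤c+1 j≢c+1)

  count-prefix : ∀ k → DownClosedOn k → ∀ j → j ∈[1, k ] → P j ⇔ j ≤ count P? k
  count-prefix zero    _      _ (s≤s _ , ())
  count-prefix (suc k) closed j (1≤j , j≤k+1) = by-cases (P? (suc k))
    where
    by-cases : Dec (P (suc k)) → P j ⇔ j ≤ count P? (suc k)
    by-cases (yes pk+1) = mk⇔ (λ _ → subst (j ≤_) (sym (count-all (suc k) all)) j≤k+1)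
                              (λ _ → all j (1≤j , j≤k+1))
      where
      all : ∀ i → i ∈[1, suc k ] → P i
      all = downClosed-≤ closed (suc k) ≤-refl pk+1
    by-cases (no ¬pk+1) with m≤n⇒m<n∨m≡n j≤k+1
    ... | inj₁ j≤k = subst (λ c → P j ⇔ j ≤ c) (sym (count-suc-no k ¬pk+1))
      (count-prefix k (λ i 1≤i i<k → closed i 1≤i (m≤n⇒m≤1+n i<k)) j (1≤j , ≤-pred j≤k))
    ... | inj₂ refl = mk⇔ (λ pk+1 → contradiction pk+1 ¬pk+1)
      (λ k+1≤count → contradiction (≤-trans k+1≤count (≤-reflexive (count-suc-no k ¬pk+1)))
                                   (<⇒≱ (s≤s (count-≤ k))))

tabulate₁ : (k : ℕ) → (ℕ → ℕ) → Vec ℕ k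
tabulate₁ zero    f = []
tabulate₁ (suc k) f = f 1 ∷ tabulate₁ k (f ∘ suc)

part-tabulate₁ : ∀ k f {i} → i ∈[1, k ] → part (tabulate₁ k f) i ≡ f i
part-tabulate₁ (suc k) f {suc zero}    _              = refl
part-tabulate₁ (suc k) f {suc (suc i)} (_ , s≤s i<k) = part-tabulate₁ k (f ∘ suc) (s≤s z≤n , i<k)

part-tabulate₁-≤ : ∀ k {f c} → (∀ i → f i ≤ c) → ∀ i → part (tabulate₁ k f) i ≤ c
part-tabulate₁-≤ zero    f≤c i             = z≤n
part-tabulate₁-≤ (suc k) f≤c zero          = z≤n
part-tabulate₁-≤ (suc k) f≤c (suc zero)    = f≤c 1
part-tabulate₁-≤ (suc k) f≤c (suc (suc i)) = part-tabulate₁-≤ k (f≤c ∘ suc) (suc i)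

sum-tabulate₁ : ∀ k f → sum (tabulate₁ k f) ≡ ∑ k f
sum-tabulate₁ zero    f = refl
sum-tabulate₁ (suc k) f = trans (cong (f 1 +_) (sum-tabulate₁ k (f ∘ suc))) (sym (∑-shift k f))

part-nonzero⇒∈ : ∀ {k} (v : Vec ℕ k) i → 1 ≤ part v i → i ∈[1, k ]
part-nonzero⇒∈ (x ∷ v) (suc zero)    _  = s≤s z≤n , s≤s z≤n
part-nonzero⇒∈ (x ∷ v) (suc (suc i)) 1≤ = s≤s z≤n , s≤s (proj₂ (part-nonzero⇒∈ v (suc i) 1≤))

IsPartition-fromNonzero : ∀ {k} (v : Vec ℕ k) →
  (∀ i → 1 ≤ part v (suc (suc i)) → part v (suc (suc i)) ≤ part v (suc i)) → IsPartition v
IsPartition-fromNonzero v decr i with part v (suc (suc i)) in eq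
... | zero  = z≤n
... | suc p = subst (_≤ part v (suc i)) eq (decr i (subst (1 ≤_) (sym eq) (s≤s z≤n)))

part-rect : ∀ m n {i} → i ∈[1, m ] → part (rect m n) i ≡ n
part-rect (suc m) n {suc zero}    _             = refl
part-rect (suc m) n {suc (suc i)} (_ , s≤s i<m) = part-rect m n (s≤s z≤n , i<m)

sum-rect : ∀ m n → sum (rect m n) ≡ m * n
sum-rect zero    n = refl
sum-rect (suc m) n = cong (n +_) (sum-rect m n)

entryAtMost? : ∀ t → Decidable (Any (_≤ t))
entryAtMost? t = Any.dec (_≤? t)

entryIs? : ∀ x → Decidable (_≡ just x)
entryIs? x c = ≡-dec _≟_ c (just x)

Any-≤-just⇔ : ∀ {t c x} → c ≡ just x → Any (_≤ t) c ⇔ x ≤ t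
Any-≤-just⇔ refl = mk⇔ Any.drop-just just

𝟙-entryAtMost-suc : ∀ s c →
  𝟙 (entryAtMost? (suc s) c) ≡ 𝟙 (entryAtMost? s c) + 𝟙 (entryIs? (suc s) c)
𝟙-entryAtMost-suc s nothing  = refl
𝟙-entryAtMost-suc s (just x) = by-cases (x ≤? s) (x ≟ suc s)
  where
  goal : Set
  goal = 𝟙 (entryAtMost? (suc s) (just x)) ≡ 𝟙 (entryAtMost? s (just x)) + 𝟙 (entryIs? (suc s) (just x))
  by-cases : Dec (x ≤ s) → Dec (x ≡ suc s) → goal
  by-cases (yes x≤s) _ =
    trans (𝟙-yes (entryAtMost? (suc s) (just x)) (just (m≤n⇒m≤1+n x≤s)))
          (sym (cong₂ _+_ (𝟙-yes (entryAtMost? s (just x)) (just x≤s))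
                          (𝟙-no (entryIs? (suc s) (just x)) (λ eq → <-irrefl (just-injective eq) (s≤s x≤s)))))
  by-cases (no x≰s) (yes refl) =
    trans (𝟙-yes (entryAtMost? (suc s) (just x)) (just ≤-refl))
          (sym (cong₂ _+_ (𝟙-no (entryAtMost? s (just x)) (x≰s ∘ Any.drop-just))
                          (𝟙-yes (entryIs? (suc s) (just x)) refl)))
  by-cases (no x≰s) (no x≢s+1) =
    trans (𝟙-no (entryAtMost? (suc s) (just x))
                (λ x≤s+1 → x≢s+1 (≤-antisym (Any.drop-just x≤s+1) (≰⇒> x≰s))))
          (sym (cong₂ _+_ (𝟙-no (entryAtMost? s (just x)) (x≰s ∘ Any.drop-just))
                          (𝟙-no (entryIs? (suc s) (just x)) (x≢s+1 ∘ just-injective))))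

lowerShape : (m n t : ℕ) → Filling → Vec ℕ m
lowerShape m n t T = tabulate₁ m (λ i → count (λ j → entryAtMost? t (T i j)) n)

lowerPart-just⁻¹ : ∀ t T {i j x} → lowerPart t T i j ≡ just x → T i j ≡ just x × x ≤ t
lowerPart-just⁻¹ t T {i} {j} eq with T i j
... | just y with y ≤? t
lowerPart-just⁻¹ t T refl | just y | yes y≤t = refl , y≤t

lowerPart-just : ∀ t T {i j x} → T i j ≡ just x → x ≤ t → lowerPart t T i j ≡ just x
lowerPart-just t T {i} {j} eq x≤t with T i j
lowerPart-just t T refl x≤t | just x with x ≤? t
... | yes _   = refl
... | no  x≰t = contradiction x≤t x≰t

dual : (m n : ℕ) → Filling → Filling
dual m n T i j = Maybe.map (suc (m * n) ∸_) (T (suc m ∸ j) (suc n ∸ i))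

dual-just⁻¹ : ∀ m n T i j {y} → dual m n T i j ≡ just y →
  ∃[ x ] T (suc m ∸ j) (suc n ∸ i) ≡ just x × suc (m * n) ∸ x ≡ y
dual-just⁻¹ m n T i j eq with T (suc m ∸ j) (suc n ∸ i)
dual-just⁻¹ m n T i j refl | just x = x , refl , refl

upperPart-dual : ∀ m n t T → t ≤ m * n → ∀ i j →
  upperPart m n t T i j ≡ lowerPart (m * n ∸ t) (dual m n T) i j
upperPart-dual m n t T t≤mn i j with T (suc m ∸ j) (suc n ∸ i)
... | nothing = refl
... | just x with x ≤? t | suc (m * n) ∸ x ≤? m * n ∸ t
...   | yes _   | no  _ = refl
...   | no  _   | yes _ = refl
...   | yes x≤t | yes le = contradiction x≤t (<⇒≱ (to (flip-≤⇔ t≤mn) le))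
...   | no  x≰t | no  le = contradiction (from (flip-≤⇔ t≤mn) (≰⇒> x≰t)) le

IsSYT-cong : ∀ {k F G} (λ′ : Vec ℕ k) → (∀ i j → F i j ≡ G i j) → IsSYT F λ′ → IsSYT G λ′
IsSYT-cong λ′ F≗G (in-shape , present , bounded , occur , unique , row , column) =
  (λ i j (x , e) → in-shape i j (x , trans (F≗G i j) e)) ,
  (λ i j d → let (x , e) = present i j d in x , trans (sym (F≗G i j)) e) ,
  (λ i j x e → bounded i j x (trans (F≗G i j) e)) ,
  (λ x 1≤x x≤sum → let (i , j , e) = occur x 1≤x x≤sum in i , j , trans (sym (F≗G i j)) e) ,
  (λ i j i′ j′ x e e′ → unique i j i′ j′ x (trans (F≗G i j) e) (trans (F≗G i′ j′) e′)) ,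
  (λ i j x y e e′ → row i j x y (trans (F≗G i j) e) (trans (F≗G i (suc j)) e′)) ,
  (λ i j x y e e′ → column i j x y (trans (F≗G i j) e) (trans (F≗G (suc i) j) e′))

module RectangularSYT {m n : ℕ} {T : Filling} (syt : IsSYT T (rect m n)) where

  private
    cells⊆diagram : ∀ i j → ∃[ x ] T i j ≡ just x → InDiagram (rect m n) i j
    cells⊆diagram = proj₁ syt
    diagram⊆cells : ∀ i j → InDiagram (rect m n) i j → ∃[ x ] T i j ≡ just x
    diagram⊆cells = proj₁ (proj₂ syt)
    entries-bounded : ∀ i j x → T i j ≡ just x → (1 ≤ x) × (x ≤ sum (rect m n))
    entries-bounded = proj₁ (proj₂ (proj₂ syt))
    entries-occur : ∀ x → 1 ≤ x → x ≤ sum (rect m n) → ∃[ i ] ∃[ j ] T i j ≡ just x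
    entries-occur = proj₁ (proj₂ (proj₂ (proj₂ syt)))

  entry-unique : ∀ i j i′ j′ x → T i j ≡ just x → T i′ j′ ≡ just x → (i ≡ i′) × (j ≡ j′)
  entry-unique = proj₁ (proj₂ (proj₂ (proj₂ (proj₂ syt))))

  row-increasing : ∀ i j x y → T i j ≡ just x → T i (suc j) ≡ just y → x < y
  row-increasing = proj₁ (proj₂ (proj₂ (proj₂ (proj₂ (proj₂ syt)))))

  column-increasing : ∀ i j x y → T i j ≡ just x → T (suc i) j ≡ just y → x < y
  column-increasing = proj₂ (proj₂ (proj₂ (proj₂ (proj₂ (proj₂ syt)))))

  cell-∈ : ∀ {i j x} → T i j ≡ just x → i ∈[1, m ] × j ∈[1, n ]
  cell-∈ {i} {j} {x} eq with cells⊆diagram i j (x , eq)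
  ... | 1≤j , j≤part with part-nonzero⇒∈ (rect m n) i (≤-trans 1≤j j≤part)
  ...   | i∈ = i∈ , 1≤j , subst (j ≤_) (part-rect m n i∈) j≤part

  cell-present : ∀ {i j} → i ∈[1, m ] → j ∈[1, n ] → ∃[ x ] T i j ≡ just x
  cell-present {i} {j} i∈ (1≤j , j≤n) =
    diagram⊆cells i j (1≤j , subst (j ≤_) (sym (part-rect m n i∈)) j≤n)

  entry-∈ : ∀ {i j x} → T i j ≡ just x → x ∈[1, m * n ]
  entry-∈ {i} {j} {x} eq with entries-bounded i j x eq
  ... | 1≤x , x≤sum = 1≤x , subst (x ≤_) (sum-rect m n) x≤sum

  entry-occurs : ∀ {x} → x ∈[1, m * n ] → ∃[ i ] ∃[ j ] T i j ≡ just x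
  entry-occurs {x} (1≤x , x≤mn) = entries-occur x 1≤x (subst (x ≤_) (sym (sum-rect m n)) x≤mn)

  count-entryIs : ∀ {x} → x ∈[1, m * n ] → ∑ m (λ i → count (entryIs? x ∘ T i) n) ≡ 1
  count-entryIs {x} x∈ with entry-occurs x∈
  ... | a , b , eq with cell-∈ eq
  ...   | a∈ , b∈ = trans
    (∑-single m a∈ λ i i≢a →
      count-none (entryIs? x ∘ T i) n λ j _ e → i≢a (proj₁ (entry-unique i j a b x e eq)))
    (count-unique (entryIs? x ∘ T a) n b∈ eq λ j e → proj₂ (entry-unique a j a b x e eq))

  count-entryAtMost : ∀ s → s ≤ m * n → ∑ m (λ i → count (entryAtMost? s ∘ T i) n) ≡ s
  count-entryAtMost zero _ =
    trans (∑-const m λ i i∈ → count-none (entryAtMost? 0 ∘ T i) n (no-entry≤0 i∈)) (*-zeroʳ m)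
    where
    no-entry≤0 : ∀ {i} → i ∈[1, m ] → ∀ j → j ∈[1, n ] → ¬ Any (_≤ 0) (T i j)
    no-entry≤0 i∈ j j∈ x≤0 with cell-present i∈ j∈
    ... | x , eq = contradiction (to (Any-≤-just⇔ eq) x≤0) (<⇒≱ (proj₁ (entry-∈ eq)))
  count-entryAtMost (suc s) s<mn = begin
    ∑ m (λ i → count (entryAtMost? (suc s) ∘ T i) n)
      ≡⟨ ∑-cong m (λ i → trans (∑-cong n (λ j → 𝟙-entryAtMost-suc s (T i j))) (∑-distrib-+ n _ _)) ⟩
    ∑ m (λ i → count (entryAtMost? s ∘ T i) n + count (entryIs? (suc s) ∘ T i) n)
      ≡⟨ ∑-distrib-+ m _ _ ⟩
    ∑ m (λ i → count (entryAtMost? s ∘ T i) n) + ∑ m (λ i → count (entryIs? (suc s) ∘ T i) n)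
      ≡⟨ cong₂ _+_ (count-entryAtMost s (<⇒≤ s<mn)) (count-entryIs (s≤s z≤n , s<mn)) ⟩
    s + 1
      ≡⟨ +-comm s 1 ⟩
    suc s ∎
    where open ≡-Reasoning

  lowerShape-≤ : ∀ t i → part (lowerShape m n t T) i ≤ n
  lowerShape-≤ t = part-tabulate₁-≤ m (λ i → count-≤ (entryAtMost? t ∘ T i) n)

  row-downClosed : ∀ t {i} → i ∈[1, m ] → DownClosedOn (entryAtMost? t ∘ T i) n
  row-downClosed t i∈ j 1≤j j<n y≤t
    with cell-present i∈ (1≤j , <⇒≤ j<n) | cell-present i∈ (s≤s z≤n , j<n)
  ... | x , eqx | y , eqy =
    from (Any-≤-just⇔ eqx) (<⇒≤ (<-≤-trans (row-increasing _ _ x y eqx eqy) (to (Any-≤-just⇔ eqy) y≤t)))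

  lowerShape-char : ∀ t {i j x} → T i j ≡ just x → j ≤ part (lowerShape m n t T) i ⇔ x ≤ t
  lowerShape-char t {i} {j} {x} eq with cell-∈ eq
  ... | i∈ , j∈ =
    subst (λ c → j ≤ c ⇔ x ≤ t) (sym (part-tabulate₁ m (λ i → count (entryAtMost? t ∘ T i) n) i∈))
          (⇔-trans (⇔-sym (count-prefix (entryAtMost? t ∘ T i) n (row-downClosed t i∈) j j∈))
                   (Any-≤-just⇔ eq))

  lowerShape-partition : ∀ t → IsPartition (lowerShape m n t T)
  lowerShape-partition t = IsPartition-fromNonzero λ′ decreasing
    where
    λ′ : Vec ℕ m
    λ′ = lowerShape m n t T
    decreasing : ∀ i → 1 ≤ part λ′ (suc (suc i)) → part λ′ (suc (suc i)) ≤ part λ′ (suc i)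
    decreasing i 1≤p with part-nonzero⇒∈ λ′ (suc (suc i)) 1≤p
    ... | _ , i+2≤m with cell-present (s≤s z≤n , i+2≤m) (1≤p , lowerShape-≤ t _)
                       | cell-present (s≤s z≤n , <⇒≤ i+2≤m) (1≤p , lowerShape-≤ t _)
    ...   | x , eqx | y , eqy = from (lowerShape-char t eqy)
            (<⇒≤ (<-≤-trans (column-increasing _ _ y x eqy eqx) (to (lowerShape-char t eqx) ≤-refl)))

  lowerShape-sum : ∀ t → t ≤ m * n → sum (lowerShape m n t T) ≡ t
  lowerShape-sum t t≤mn = trans (sum-tabulate₁ m _) (count-entryAtMost t t≤mn)

  lowerPart-SYT : ∀ t → t ≤ m * n → IsSYT (lowerPart t T) (lowerShape m n t T)
  lowerPart-SYT t t≤mn = in-shape , present , bounded , occur , unique , row , column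
    where
    λ′ : Vec ℕ m
    λ′ = lowerShape m n t T
    in-shape : ∀ i j → ∃[ x ] lowerPart t T i j ≡ just x → InDiagram λ′ i j
    in-shape i j (x , eq) with lowerPart-just⁻¹ t T eq
    ... | eq′ , x≤t = proj₁ (proj₂ (cell-∈ eq′)) , from (lowerShape-char t eq′) x≤t
    present : ∀ i j → InDiagram λ′ i j → ∃[ x ] lowerPart t T i j ≡ just x
    present i j (1≤j , j≤p) with cell-present (part-nonzero⇒∈ λ′ i (≤-trans 1≤j j≤p))
                                               (1≤j , ≤-trans j≤p (lowerShape-≤ t i))
    ... | x , eq = x , lowerPart-just t T eq (to (lowerShape-char t eq) j≤p)
    bounded : ∀ i j x → lowerPart t T i j ≡ just x → (1 ≤ x) × (x ≤ sum λ′)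
    bounded i j x eq with lowerPart-just⁻¹ t T eq
    ... | eq′ , x≤t = proj₁ (entry-∈ eq′) , subst (x ≤_) (sym (lowerShape-sum t t≤mn)) x≤t
    occur : ∀ x → 1 ≤ x → x ≤ sum λ′ → ∃[ i ] ∃[ j ] lowerPart t T i j ≡ just x
    occur x 1≤x x≤sum =
      let x≤t = subst (x ≤_) (lowerShape-sum t t≤mn) x≤sum
          (i , j , eq) = entry-occurs (1≤x , ≤-trans x≤t t≤mn)
      in i , j , lowerPart-just t T eq x≤t
    inT : ∀ {i j x} → lowerPart t T i j ≡ just x → T i j ≡ just x
    inT = proj₁ ∘ lowerPart-just⁻¹ t T
    unique : ∀ i j i′ j′ x → lowerPart t T i j ≡ just x → lowerPart t T i′ j′ ≡ just x →
             (i ≡ i′) × (j ≡ j′)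
    unique i j i′ j′ x e e′ = entry-unique i j i′ j′ x (inT e) (inT e′)
    row : ∀ i j x y → lowerPart t T i j ≡ just x → lowerPart t T i (suc j) ≡ just y → x < y
    row i j x y e e′ = row-increasing i j x y (inT e) (inT e′)
    column : ∀ i j x y → lowerPart t T i j ≡ just x → lowerPart t T (suc i) j ≡ just y → x < y
    column i j x y e e′ = column-increasing i j x y (inT e) (inT e′)

  dual-cell-∈ : ∀ i j {y} → dual m n T i j ≡ just y → i ∈[1, n ] × j ∈[1, m ]
  dual-cell-∈ i j eq with dual-just⁻¹ m n T i j eq
  ... | _ , eqx , _ with cell-∈ eqx
  ...   | r∈ , c∈ = flip-∈⁻¹ c∈ , flip-∈⁻¹ r∈

  dual-SYT : IsSYT (dual m n T) (rect n m)
  dual-SYT = in-shape , present , bounded , occur , unique , row , column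
    where
    N : ℕ
    N = m * n
    sum≡N : sum (rect n m) ≡ N
    sum≡N = trans (sum-rect n m) (*-comm n m)
    in-shape : ∀ i j → ∃[ y ] dual m n T i j ≡ just y → InDiagram (rect n m) i j
    in-shape i j (y , eq) with dual-cell-∈ i j eq
    ... | i∈ , (1≤j , j≤m) = 1≤j , subst (j ≤_) (sym (part-rect n m i∈)) j≤m
    present : ∀ i j → InDiagram (rect n m) i j → ∃[ y ] dual m n T i j ≡ just y
    present i j (1≤j , j≤p) with part-nonzero⇒∈ (rect n m) i (≤-trans 1≤j j≤p)
    ... | i∈ with cell-present (flip-∈ (1≤j , subst (j ≤_) (part-rect n m i∈) j≤p)) (flip-∈ i∈)
    ...   | x , eq = suc N ∸ x , cong (Maybe.map (suc N ∸_)) eq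
    bounded : ∀ i j y → dual m n T i j ≡ just y → (1 ≤ y) × (y ≤ sum (rect n m))
    bounded i j y eq with dual-just⁻¹ m n T i j eq
    ... | x , eqx , refl = subst (λ s → suc N ∸ x ∈[1, s ]) (sym sum≡N) (flip-∈ (entry-∈ eqx))
    occur : ∀ y → 1 ≤ y → y ≤ sum (rect n m) → ∃[ i ] ∃[ j ] dual m n T i j ≡ just y
    occur y 1≤y y≤sum =
      let y≤N = subst (y ≤_) sum≡N y≤sum
          (a , b , eq) = entry-occurs (flip-∈ (1≤y , y≤N))
          ((_ , a≤m) , (_ , b≤n)) = cell-∈ eq
      in suc n ∸ b , suc m ∸ a , (begin
        Maybe.map (suc N ∸_) (T (suc m ∸ (suc m ∸ a)) (suc n ∸ (suc n ∸ b)))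
          ≡⟨ cong₂ (λ r c → Maybe.map (suc N ∸_) (T r c)) (flip-involutive a≤m)
                                                            (flip-involutive b≤n) ⟩
        Maybe.map (suc N ∸_) (T a b)
          ≡⟨ cong (Maybe.map (suc N ∸_)) eq ⟩
        just (suc N ∸ (suc N ∸ y))
          ≡⟨ cong just (flip-involutive y≤N) ⟩
        just y ∎)
      where open ≡-Reasoning
    unique : ∀ i j i′ j′ y → dual m n T i j ≡ just y → dual m n T i′ j′ ≡ just y →
             (i ≡ i′) × (j ≡ j′)
    unique i j i′ j′ y e e′
      with dual-just⁻¹ m n T i j e | dual-just⁻¹ m n T i′ j′ e′ | dual-cell-∈ i j e | dual-cell-∈ i′ j′ e′
    ... | x , eqx , refl | x′ , eqx′ , x′↦y | (_ , i≤n) , (_ , j≤m) | (_ , i′≤n) , (_ , j′≤m)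
      with flip-injective (proj₂ (entry-∈ eqx)) (proj₂ (entry-∈ eqx′)) (sym x′↦y)
    ...   | refl with entry-unique _ _ _ _ x eqx eqx′
    ...     | r≡r′ , c≡c′ = flip-injective i≤n i′≤n c≡c′ , flip-injective j≤m j′≤m r≡r′
    row : ∀ i j y y′ → dual m n T i j ≡ just y → dual m n T i (suc j) ≡ just y′ → y < y′
    row i j y y′ e e′
      with dual-just⁻¹ m n T i j e | dual-just⁻¹ m n T i (suc j) e′ | dual-cell-∈ i j e
    ... | x , eqx , refl | x′ , eqx′ , refl | _ , (_ , j≤m) =
      flip-< (column-increasing (m ∸ j) (suc n ∸ i) x′ x eqx′
                (subst (λ r → T r (suc n ∸ i) ≡ just x) (flip-suc j≤m) eqx))
             (proj₂ (entry-∈ eqx))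
    column : ∀ i j y y′ → dual m n T i j ≡ just y → dual m n T (suc i) j ≡ just y′ → y < y′
    column i j y y′ e e′
      with dual-just⁻¹ m n T i j e | dual-just⁻¹ m n T (suc i) j e′ | dual-cell-∈ i j e
    ... | x , eqx , refl | x′ , eqx′ , refl | (_ , i≤n) , _ =
      flip-< (row-increasing (suc m ∸ j) (n ∸ i) x′ x eqx′
                (subst (λ c → T (suc m ∸ j) c ≡ just x) (flip-suc i≤n) eqx))
             (proj₂ (entry-∈ eqx))

greatest-≤ : ∀ {p} {P : Pred ℕ p} → Decidable P → P 0 → ∀ M →
  ∃[ i ] i ≤ M × P i × (∀ j → i < j → j ≤ M → ¬ P j)
greatest-≤ P? p0 zero = 0 , z≤n , p0 , λ j 0<j j≤0 → contradiction (≤-trans 0<j j≤0) λ ()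
greatest-≤ {P = P} P? p0 (suc M) with P? (suc M)
... | yes pM+1 = suc M , ≤-refl , pM+1 , λ j M+1<j j≤M+1 → contradiction (≤-trans M+1<j j≤M+1) (n≮n _)
... | no ¬pM+1 with greatest-≤ P? p0 M
...   | i , i≤M , pi , none-above = i , m≤n⇒m≤1+n i≤M , pi , none-above′
  where
  none-above′ : ∀ j → i < j → j ≤ suc M → ¬ P j
  none-above′ j i<j j≤M+1 with m≤n⇒m<n∨m≡n j≤M+1
  ... | inj₁ j≤M = none-above j i<j (≤-pred j≤M)
  ... | inj₂ refl = ¬pM+1

cross-< : ∀ {x y r s} → y ≤ r → s < x → y + suc s < x + suc r
cross-< {x} {y} {r} {s} y≤r s<x = begin-strict
  y + suc s ≤⟨ +-mono-≤ y≤r s<x ⟩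
  r + x     ≡⟨ +-comm r x ⟩
  x + r     <⟨ +-monoʳ-< x (n<1+n r) ⟩
  x + suc r ∎
  where open ≤-Reasoning

staircasePart : ∀ {k} → Vec ℕ k → ℕ → ℕ
staircasePart {k} λ′ i = part λ′ i + (suc k ∸ i)

staircasePart-∈ : ∀ {k N} (λ′ : Vec ℕ k) → (∀ i → part λ′ i ≤ N) →
  ∀ {i} → i ∈[1, k ] → staircasePart λ′ i ∈[1, N + k ]
staircasePart-∈ λ′ ≤N {i} i∈ with flip-∈ i∈
... | 1≤ , ≤k = ≤-trans 1≤ (m≤n+m _ (part λ′ i)) , +-mono-≤ (≤N i) ≤k

staircasePart-suc : ∀ {k} (λ′ : Vec ℕ k) {i} → i ≤ k →
  staircasePart λ′ i ≡ part λ′ i + suc (k ∸ i)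
staircasePart-suc λ′ {i} i≤k = cong (part λ′ i +_) (flip-suc i≤k)

-- Cell (a, n + 1 - k) of the m × n rectangle is in λ₁ iff cell (k, m + 1 - a) is not in λ₂.
Complementary : ∀ {m n} → Vec ℕ m → Vec ℕ n → Set
Complementary {m} {n} λ₁ λ₂ = ∀ {a k} → a ∈[1, m ] → k ∈[1, n ] →
  suc n ∸ k ≤ part λ₁ a ⇔ part λ₂ k < suc m ∸ a

module _ {m n} (λ₁ : Vec ℕ m) (λ₂ : Vec ℕ n)
         (λ₁≤n : ∀ i → part λ₁ i ≤ n) (λ₂≤m : ∀ k → part λ₂ k ≤ m)
         (complementary : Complementary λ₁ λ₂) where

  complementary-cases : ∀ {a k} → a ∈[1, m ] → k ∈[1, n ] →
      (suc (n ∸ k) ≤ part λ₁ a × part λ₂ k ≤ m ∸ a)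
    ⊎ (part λ₁ a ≤ n ∸ k × suc (m ∸ a) ≤ part λ₂ k)
  complementary-cases {a} {k} a∈@(_ , a≤m) k∈@(_ , k≤n) with suc n ∸ k ≤? part λ₁ a
  ... | yes c≤λ₁ = inj₁ ( subst (_≤ part λ₁ a) (flip-suc k≤n) c≤λ₁
                       , ≤-pred (subst (part λ₂ k <_) (flip-suc a≤m) (to (complementary a∈ k∈) c≤λ₁)))
  ... | no  c≰λ₁ = inj₂ ( ≤-pred (subst (part λ₁ a <_) (flip-suc k≤n) (≰⇒> c≰λ₁))
                       , subst (_≤ part λ₂ k) (flip-suc a≤m) (≮⇒≥ (c≰λ₁ ∘ from (complementary a∈ k∈))))

  staircase-disjoint : ∀ v → PartOfPlusStaircase λ₁ v → PartOfPlusStaircase λ₂ v → ⊥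
  staircase-disjoint v (i , 1≤i , i≤m , αᵢ≡v) (k , 1≤k , k≤n , βₖ≡v) =
    [ (λ (c<λ₁ , λ₂≤r) → <-irrefl (sym α≡β) (cross-< λ₂≤r c<λ₁))
    , (λ (λ₁≤c , r<λ₂) → <-irrefl α≡β (cross-< λ₁≤c r<λ₂))
    ]′ (complementary-cases (1≤i , i≤m) (1≤k , k≤n))
    where
    α≡β : part λ₁ i + suc (m ∸ i) ≡ part λ₂ k + suc (n ∸ k)
    α≡β = begin
      part λ₁ i + suc (m ∸ i) ≡⟨ staircasePart-suc λ₁ i≤m ⟨
      staircasePart λ₁ i      ≡⟨ trans αᵢ≡v (sym βₖ≡v) ⟩
      staircasePart λ₂ k      ≡⟨ staircasePart-suc λ₂ k≤n ⟩
      part λ₂ k + suc (n ∸ k) ∎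
      where open ≡-Reasoning

  part₂-≤ : ∀ {i k} → i ∈[1, m ] → k ∈[1, n ] →
    n ∸ k + suc (m ∸ i) < staircasePart λ₁ i → part λ₂ k ≤ m ∸ i
  part₂-≤ {i} i∈@(_ , i≤m) k∈ c+r<α with complementary-cases i∈ k∈
  ... | inj₁ (_ , λ₂≤r) = λ₂≤r
  ... | inj₂ (λ₁≤c , _) = contradiction
    (≤-trans (≤-reflexive (staircasePart-suc λ₁ i≤m)) (+-monoˡ-≤ (suc (m ∸ i)) λ₁≤c)) (<⇒≱ c+r<α)

  part₂-≥ : ∀ {i k} → suc i ≤ m → k ∈[1, n ] →
    staircasePart λ₁ (suc i) < n ∸ k + suc (m ∸ i) → m ∸ i ≤ part λ₂ k
  part₂-≥ {i} {k} i<m k∈ α<c+r with complementary-cases (s≤s z≤n , i<m) k∈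
  ... | inj₁ (c<λ₁ , _) = contradiction
    (≤-trans (≤-reflexive (+-suc (n ∸ k) (m ∸ i))) (+-monoˡ-≤ (m ∸ i) c<λ₁)) (<⇒≱ α<c+r)
  ... | inj₂ (_ , r<λ₂) = subst (_≤ part λ₂ k) (sym (flip-suc i<m)) r<λ₂

  -- The hypotheses say that v lies strictly between the i-th and the (i+1)-st part of λ₁ + [m]
  -- (read as ∞ for i = 0 and as 0 for i = m).  With r = m - i and k = n + r + 1 - v,
  -- complementarity then forces λ₂_k = r, that is, v = λ₂_k + (n + 1 - k).
  gap⇒part₂ : ∀ {v i} → 1 ≤ v → v ≤ m + n → i ≤ m →
    (i ≡ 0 ⊎ (1 ≤ i × v < staircasePart λ₁ i)) →
    (i ≡ m ⊎ (suc i ≤ m × staircasePart λ₁ (suc i) < v)) →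
    PartOfPlusStaircase λ₂ v
  gap⇒part₂ {v} {i} 1≤v v≤m+n i≤m below above = k , 1≤k , k≤n , β≡v
    where
    r : ℕ
    r = m ∸ i
    r<v : r < v
    r<v = [ (λ { refl → subst (_< v) (sym (n∸n≡0 m)) 1≤v })
          , (λ (_ , α<v) → ≤-<-trans (m≤n+m r _) α<v) ]′ above
    α≤n+r+1 : staircasePart λ₁ i ≤ suc (n + r)
    α≤n+r+1 = begin
      staircasePart λ₁ i    ≡⟨ staircasePart-suc λ₁ i≤m ⟩
      part λ₁ i + suc r     ≤⟨ +-monoˡ-≤ (suc r) (λ₁≤n i) ⟩
      n + suc r             ≡⟨ +-suc n r ⟩
      suc (n + r)           ∎
      where open ≤-Reasoning
    v≤n+r : v ≤ n + r
    v≤n+r = [ (λ { refl → subst (v ≤_) (+-comm m n) v≤m+n })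
            , (λ (_ , v<α) → ≤-pred (≤-trans v<α α≤n+r+1)) ]′ below
    c : ℕ
    c = v ∸ suc r
    c+r+1≡v : c + suc r ≡ v
    c+r+1≡v = m∸n+n≡m r<v
    c<n : c < n
    c<n = +-cancelʳ-≤ r (suc c) n (subst (_≤ n + r) (trans (sym c+r+1≡v) (+-suc c r)) v≤n+r)
    k : ℕ
    k = n ∸ c
    1≤k : 1 ≤ k
    1≤k = m<n⇒0<n∸m c<n
    k≤n : k ≤ n
    k≤n = m∸n≤m n c
    v≡ : n ∸ k + suc r ≡ v
    v≡ = trans (cong (_+ suc r) (m∸[m∸n]≡n (<⇒≤ c<n))) c+r+1≡v
    λ₂ₖ≡r : part λ₂ k ≡ r
    λ₂ₖ≡r = ≤-antisym
      ([ (λ { refl → λ₂≤m k })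
       , (λ (1≤i , v<α) → part₂-≤ (1≤i , i≤m) (1≤k , k≤n) (subst (_< staircasePart λ₁ i) (sym v≡) v<α))
       ]′ below)
      ([ (λ { refl → subst (_≤ part λ₂ k) (sym (n∸n≡0 m)) z≤n })
       , (λ (i<m , α<v) → part₂-≥ i<m (1≤k , k≤n) (subst (staircasePart λ₁ (suc i) <_) (sym v≡) α<v))
       ]′ above)
    β≡v : staircasePart λ₂ k ≡ v
    β≡v = begin
      staircasePart λ₂ k      ≡⟨ staircasePart-suc λ₂ k≤n ⟩
      part λ₂ k + suc (n ∸ k) ≡⟨ cong (_+ suc (n ∸ k)) λ₂ₖ≡r ⟩
      r + suc (n ∸ k)         ≡⟨ +-comm r (suc (n ∸ k)) ⟩
      suc (n ∸ k + r)         ≡⟨ sym (+-suc (n ∸ k) r) ⟩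
      n ∸ k + suc r           ≡⟨ v≡ ⟩
      v                       ∎
      where open ≡-Reasoning

  greatest⇒next-below : ∀ {v i} → i ≤ m →
    (∀ j → i < j → j ≤ m → ¬ (j ≡ 0 ⊎ v ≤ staircasePart λ₁ j)) →
    i ≡ m ⊎ (suc i ≤ m × staircasePart λ₁ (suc i) < v)
  greatest⇒next-below {v} {i} i≤m none-above with suc i ≤? m
  ... | yes i<m = inj₂ (i<m , ≰⇒> (none-above (suc i) ≤-refl i<m ∘ inj₂))
  ... | no  i≮m = inj₁ (≤-antisym i≤m (≮⇒≥ i≮m))

  staircase-cover : ∀ v → 1 ≤ v → v ≤ m + n → PartOfPlusStaircase λ₁ v ⊎ PartOfPlusStaircase λ₂ v
  staircase-cover v 1≤v v≤m+n
    with greatest-≤ (λ i → (i ≟ 0) ⊎-dec (v ≤? staircasePart λ₁ i)) (inj₁ refl) m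
  ... | zero , _ , _ , none-above =
    inj₂ (gap⇒part₂ 1≤v v≤m+n z≤n (inj₁ refl) (greatest⇒next-below z≤n none-above))
  ... | suc i , i<m , inj₂ v≤α , none-above with staircasePart λ₁ (suc i) ≟ v
  ...   | yes α≡v = inj₁ (suc i , s≤s z≤n , i<m , α≡v)
  ...   | no  α≢v = inj₂ (gap⇒part₂ 1≤v v≤m+n i<m (inj₂ (s≤s z≤n , ≤∧≢⇒< v≤α (α≢v ∘ sym)))
                                    (greatest⇒next-below i<m none-above))

  staircase-disjointUnion : DisjointUnionRange (m + n) (PartOfPlusStaircase λ₁) (PartOfPlusStaircase λ₂)
  staircase-disjointUnion =
    staircase-cover ,
    (λ v (i , 1≤i , i≤m , αᵢ≡v) → subst (_∈[1, m + n ]) αᵢ≡v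
      (subst (staircasePart λ₁ i ∈[1,_]) (+-comm n m) (staircasePart-∈ λ₁ λ₁≤n (1≤i , i≤m)))) ,
    (λ v (k , 1≤k , k≤n , βₖ≡v) →
      subst (_∈[1, m + n ]) βₖ≡v (staircasePart-∈ λ₂ λ₂≤m (1≤k , k≤n))) ,
    staircase-disjoint

module _ {m n : ℕ} {T : Filling} (syt : IsSYT T (rect m n)) where
  open RectangularSYT {m} {n} syt
  private module Dual = RectangularSYT {n} {m} dual-SYT

  lowerShapes-complementary : ∀ t → t ≤ m * n →
    Complementary (lowerShape m n t T) (lowerShape n m (m * n ∸ t) (dual m n T))
  lowerShapes-complementary t t≤mn {a} {k} a∈@(_ , a≤m) k∈ with cell-present a∈ (flip-∈ k∈)
  ... | x , eq = mk⇔ (λ c≤λ₁ → ≰⇒> λ j≤λ₂ → <⇒≱ (to flip (to char₂ j≤λ₂)) (to char₁ c≤λ₁))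
                     (λ λ₂<j → from char₁ (≮⇒≥ λ t<x → <⇒≱ λ₂<j (from char₂ (from flip t<x))))
    where
    char₁ : suc n ∸ k ≤ part (lowerShape m n t T) a ⇔ x ≤ t
    char₁ = lowerShape-char t eq
    dual-eq : dual m n T k (suc m ∸ a) ≡ just (suc (m * n) ∸ x)
    dual-eq = trans (cong (λ r → Maybe.map (suc (m * n) ∸_) (T r (suc n ∸ k))) (flip-involutive a≤m))
                    (cong (Maybe.map (suc (m * n) ∸_)) eq)
    char₂ : suc m ∸ a ≤ part (lowerShape n m (m * n ∸ t) (dual m n T)) k ⇔ suc (m * n) ∸ x ≤ m * n ∸ t
    char₂ = Dual.lowerShape-char (m * n ∸ t) dual-eq
    flip : suc (m * n) ∸ x ≤ m * n ∸ t ⇔ t < x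
    flip = flip-≤⇔ t≤mn

lemma5p2 : (m n t : ℕ) → t ≤ m * n → (T : Filling) → IsSYT T (rect m n) →
    ∃[ λ₁ ] ∃[ λ₂ ]
      ( IsPartition {m} λ₁ × IsSYT (lowerPart t T) λ₁
      × IsPartition {n} λ₂ × IsSYT (upperPart m n t T) λ₂
      × DisjointUnionRange (m + n) (PartOfPlusStaircase λ₁) (PartOfPlusStaircase λ₂) )
lemma5p2 m n t t≤mn T syt =
    λ₁ , λ₂
  , lowerShape-partition t , lowerPart-SYT t t≤mn
  , Dual.lowerShape-partition t′
  , IsSYT-cong λ₂ (λ i j → sym (upperPart-dual m n t T t≤mn i j)) (Dual.lowerPart-SYT t′ t′≤nm)
  , staircase-disjointUnion λ₁ λ₂ (lowerShape-≤ t) (Dual.lowerShape-≤ t′)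
                            (lowerShapes-complementary syt t t≤mn)
  where
  open RectangularSYT {m} {n} syt
  module Dual = RectangularSYT {n} {m} dual-SYT
  t′ : ℕ
  t′ = m * n ∸ t
  λ₁ : Vec ℕ m
  λ₁ = lowerShape m n t T
  λ₂ : Vec ℕ n
  λ₂ = lowerShape n m t′ (dual m n T)
  t′≤nm : t′ ≤ n * m
  t′≤nm = subst (t′ ≤_) (*-comm m n) (m∸n≤m (m * n) t)
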